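{- Let $U=\{1,2,\dots,n\}$ and fix sets $A,B\subseteq U$. Define $h_{AB}:2^U\to\mathbb{Z}$ by $h_{AB}(S)=2|S|+(-1)^{|S\cap A|}+(-1)^{|S\cap B|}$. Then: (i) if $A\cap B=\emptyset$, then $h_{AB}$ is monotone; (ii) if $|A\cap B|=1$, then $h_{AB}$ is $\tfrac18$-far from monotone.
   Context: Subsets of $U$ are identified with their characteristic vectors in $\{0,1\}^n$. A function $g:2^U\to\mathbb{Z}$ is monotone if $g(S)\le g(T)$ whenever $S\subseteq T$ (equivalently, $g(S)\le g(S\cup\{i\})$ for all $S$ and $i\notin S$). A function $h$ is $\epsilon$-far from monotone if for every monotone $g:2^U\to\mathbb{Z}$, $h$ and $g$ differ on at least $\epsilon\cdot 2^n$ sets $S\subseteq U$. -}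

module Defs where

open import Data.Nat using (ℕ; zero; suc; _*_; _^_; _≤_)
open import Data.Integer as ℤ using (ℤ; +_; -_)
open import Data.Bool using (Bool; true; false)
open import Data.Vec using (Vec; []; _∷_)
open import Data.List using (List; []; _∷_; map; _++_; length; filter)
open import Data.Fin.Subset using (Subset; _⊆_; _∩_; ∣_∣; ⊥)
open import Relation.Nullary using (¬_)
open import Relation.Nullary.Decidable using (¬?)
open import Data.Integer.Properties using () renaming (_≟_ to _≟ℤ_)

negOnePow : ℕ → ℤ
negOnePow zero = + 1
negOnePow (suc k) = - negOnePow k

h : ∀ {n} → Subset n → Subset n → Subset n → ℤ
h A B S = (+ (2 * ∣ S ∣) ℤ.+ negOnePow ∣ S ∩ A ∣) ℤ.+ negOnePow ∣ S ∩ B ∣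

Monotone : ∀ {n} → (Subset n → ℤ) → Set
Monotone {n} g = ∀ (S T : Subset n) → S ⊆ T → g S ℤ.≤ g T

allSubsets : ∀ n → List (Subset n)
allSubsets zero = [] ∷ []
allSubsets (suc n) = map (true ∷_) (allSubsets n) ++ map (false ∷_) (allSubsets n)

numDiff : ∀ {n} → (Subset n → ℤ) → (Subset n → ℤ) → ℕ
numDiff {n} f g = length (filter (λ S → ¬? (f S ≟ℤ g S)) (allSubsets n))

-- ε-far from monotone with ε = p/q (q > 0): for every monotone g,
-- numDiff f g ≥ (p/q)·2^n, i.e. p · 2^n ≤ q · numDiff f g
FarFromMonotone : ∀ {n} → ℕ → ℕ → (Subset n → ℤ) → Set
FarFromMonotone {n} p q f = ∀ (g : Subset n → ℤ) → Monotone g → p * 2 ^ n ≤ q * numDiff f g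

module Submission where

-- Inserting an element i ∉ S raises 2|S| by 2 and flips the sign (-1)^|S ∩ C| exactly for
-- the sets C containing i. If A and B are disjoint, at most one of the two signs flips, so every
-- insertion raises h, and h is monotone. If i ∈ A ∩ B, inserting i into a set S ∌ i for which
-- |S ∩ A| and |S ∩ B| are both even lowers h by 2; a monotone g must disagree with h on S or on
-- S ∪ {i}, and these pairs are disjoint for distinct S. Such S are at least 2^n/8 in number: with
-- the characters χ_C(S) = (-1)^|S ∩ C|, eight times their count is Σ_S (1+χ_{i})(1+χ_A)(1+χ_B),
-- and expanding the product (χ_C χ_D = χ_{C ⊕ D}) gives 2^n plus character sums Σ_S χ_D(S) ≥ 0.

open import Defs
open import Data.Nat using (ℕ)
open import Data.Product using (_×_)
open import Relation.Binary.PropositionalEquality using (_≡_)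
open import Data.Fin.Subset using (Subset; _∩_; ∣_∣; ⊥)

open import Level using (Level)
open import Function using (_∘_)
open import Data.Bool using (true; false; _∧_; _xor_; if_then_else_)
open import Data.Nat using (zero; suc; _^_)
import Data.Nat as ℕ
import Data.Nat.Properties as ℕ
open import Data.Integer using (ℤ; +_; -_; _+_; _*_; _≤_; _<_; +≤+; +<+; -≤+)
open import Data.Integer.Properties
  using (≤-refl; ≤-reflexive; ≤-trans; <⇒≱; drop‿+≤+; _<?_; module ≤-Reasoning;
         +-assoc; +-identityˡ; +-identityʳ; +-inverseˡ; +-mono-≤; +-monoˡ-≤; +-monoʳ-≤; +-monoʳ-<; i≤j+i;
         *-identityʳ; *-zeroʳ; *-distribˡ-+; *-monoˡ-≤-nonNeg;
         neg-involutive; neg-distrib-+; neg-distribˡ-*; neg-distribʳ-*; pos-+; pos-*;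
         +-commutativeSemigroup)
  renaming (_≟_ to _≟ℤ_)
open import Data.Integer.Tactic.RingSolver using (solve-∀)
open import Algebra.Properties.CommutativeSemigroup +-commutativeSemigroup
  using (x∙yz≈y∙xz) renaming (interchange to +-interchange)
open import Data.Fin using (Fin) renaming (zero to fzero; suc to fsuc)
open import Data.Fin.Subset using (_∈_; _∉_; ⁅_⁆; ⊤; Nonempty)
open import Data.Fin.Subset.Properties
  using (_∈?_; nonempty?; Empty-unique; ∣⊥∣≡0; ∉⊥; ∈⊤; x∈p∩q⁺; x∈p∩q⁻; drop-there; drop-not-there;
         drop-∷-⊆; s⊆s; out⊆; ⊆-refl; ∩-zeroʳ; ∩-identityʳ)
open import Data.Vec using ([]; _∷_; zipWith; _[_]≔_; here; there)
open import Data.List using (List; []; _∷_; length; filter; map; _++_)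
import Data.List.Properties as List
open import Data.List.Relation.Unary.All using (All; []; _∷_)
open import Data.Product using (_,_; map₁)
open import Data.Sum using (_⊎_; inj₁; inj₂)
open import Relation.Nullary using (Dec; does; yes; no; contradiction)
open import Relation.Nullary.Decidable using (¬?; _×-dec_)
open import Relation.Unary using (Pred; Decidable)
open import Relation.Binary.PropositionalEquality
  using (_≢_; refl; sym; trans; cong; cong₂; subst; module ≡-Reasoning)

private
  variable
    ℓ : Level
    n : ℕ

∑ : ∀ n → (Subset n → ℤ) → ℤ
∑ zero    f = f []
∑ (suc n) f = ∑ n (f ∘ (true ∷_)) + ∑ n (f ∘ (false ∷_))

∑-cong : ∀ n {f g : Subset n → ℤ} → (∀ S → f S ≡ g S) → ∑ n f ≡ ∑ n g
∑-cong zero    f≗g = f≗g []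
∑-cong (suc n) f≗g = cong₂ _+_ (∑-cong n (f≗g ∘ (true ∷_))) (∑-cong n (f≗g ∘ (false ∷_)))

∑-mono-≤ : ∀ n {f g : Subset n → ℤ} → (∀ S → f S ≤ g S) → ∑ n f ≤ ∑ n g
∑-mono-≤ zero    f≤g = f≤g []
∑-mono-≤ (suc n) f≤g = +-mono-≤ (∑-mono-≤ n (f≤g ∘ (true ∷_))) (∑-mono-≤ n (f≤g ∘ (false ∷_)))

∑-+ : ∀ n (f g : Subset n → ℤ) → ∑ n (λ S → f S + g S) ≡ ∑ n f + ∑ n g
∑-+ zero    f g = refl
∑-+ (suc n) f g =
  trans (cong₂ _+_ (∑-+ n _ _) (∑-+ n _ _)) (+-interchange (∑ n _) (∑ n _) (∑ n _) (∑ n _))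

∑-neg : ∀ n (f : Subset n → ℤ) → ∑ n (λ S → - f S) ≡ - ∑ n f
∑-neg zero    f = refl
∑-neg (suc n) f =
  trans (cong₂ _+_ (∑-neg n _) (∑-neg n _)) (sym (neg-distrib-+ (∑ n _) (∑ n _)))

∑-*ˡ : ∀ n c (f : Subset n → ℤ) → ∑ n (λ S → c * f S) ≡ c * ∑ n f
∑-*ˡ zero    c f = refl
∑-*ˡ (suc n) c f =
  trans (cong₂ _+_ (∑-*ˡ n c _) (∑-*ˡ n c _)) (sym (*-distribˡ-+ c (∑ n _) (∑ n _)))

∑-1 : ∀ n → ∑ n (λ _ → + 1) ≡ + (2 ^ n)
∑-1 zero    = refl
∑-1 (suc n) = begin
  ∑ n (λ _ → + 1) + ∑ n (λ _ → + 1) ≡⟨ cong₂ _+_ (∑-1 n) (∑-1 n) ⟩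
  + (2 ^ n) + + (2 ^ n)             ≡⟨ pos-+ (2 ^ n) (2 ^ n) ⟨
  + (2 ^ n ℕ.+ 2 ^ n)               ≡⟨ cong (λ m → + (2 ^ n ℕ.+ m)) (ℕ.+-identityʳ (2 ^ n)) ⟨
  + (2 ^ suc n)                     ∎
  where open ≡-Reasoning

𝟙 : ∀ {A : Set ℓ} → Dec A → ℤ
𝟙 a? = if does a? then + 1 else + 0

𝟙-nonneg : ∀ {A : Set ℓ} (a? : Dec A) → + 0 ≤ 𝟙 a?
𝟙-nonneg (yes _) = +≤+ ℕ.z≤n
𝟙-nonneg (no _)  = ≤-refl

𝟙-mono : ∀ {ℓ′} {A : Set ℓ} {B : Set ℓ′} (a? : Dec A) (b? : Dec B) → (A → B) → 𝟙 a? ≤ 𝟙 b?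
𝟙-mono a? b? A→B with a? | b?
... | no _  | no _  = ≤-refl
... | no _  | yes _ = +≤+ ℕ.z≤n
... | yes _ | yes _ = ≤-refl
... | yes a | no ¬b = contradiction (A→B a) ¬b

𝟙-⊎ : ∀ {ℓ₁ ℓ₂} {A : Set ℓ} {B : Set ℓ₁} {C : Set ℓ₂} (a? : Dec A) (b? : Dec B) (c? : Dec C) →
  (A → B ⊎ C) → 𝟙 a? ≤ 𝟙 b? + 𝟙 c?
𝟙-⊎ a? b? c? A→B⊎C with a? | b? | c?
... | no _  | b?    | c?    = +-mono-≤ (𝟙-nonneg b?) (𝟙-nonneg c?)
... | yes _ | yes _ | yes _ = +≤+ (ℕ.s≤s ℕ.z≤n)
... | yes _ | yes _ | no _  = ≤-refl
... | yes _ | no _  | yes _ = ≤-refl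
... | yes a | no ¬b | no ¬c with A→B⊎C a
...   | inj₁ b = contradiction b ¬b
...   | inj₂ c = contradiction c ¬c

length-filter-map : ∀ {a b} {A : Set a} {B : Set b} {P : Pred B ℓ} (P? : Decidable P) (g : A → B) xs →
  length (filter P? (map g xs)) ≡ length (filter (P? ∘ g) xs)
length-filter-map P? g []       = refl
length-filter-map P? g (x ∷ xs) with does (P? (g x))
... | true  = cong suc (length-filter-map P? g xs)
... | false = length-filter-map P? g xs

∑-𝟙 : ∀ n {P : Pred (Subset n) ℓ} (P? : Decidable P) →
  ∑ n (𝟙 ∘ P?) ≡ + length (filter P? (allSubsets n))
∑-𝟙 zero P? with does (P? [])
... | true  = refl
... | false = refl
∑-𝟙 (suc n) P? = begin
  ∑ n (𝟙 ∘ P? ∘ (true ∷_)) + ∑ n (𝟙 ∘ P? ∘ (false ∷_))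
    ≡⟨ cong₂ _+_ (∑-𝟙 n (P? ∘ (true ∷_))) (∑-𝟙 n (P? ∘ (false ∷_))) ⟩
  + length (filter (P? ∘ (true ∷_)) Sₙ) + + length (filter (P? ∘ (false ∷_)) Sₙ)
    ≡⟨ cong₂ (λ a b → + a + + b) (length-filter-map P? (true ∷_) Sₙ)
                                 (length-filter-map P? (false ∷_) Sₙ) ⟨
  + length Fᵗ + + length Fᶠ
    ≡⟨ pos-+ (length Fᵗ) (length Fᶠ) ⟨
  + (length Fᵗ ℕ.+ length Fᶠ)
    ≡⟨ cong +_ (List.length-++ Fᵗ) ⟨
  + length (Fᵗ ++ Fᶠ)
    ≡⟨ cong (+_ ∘ length) (List.filter-++ P? (map (true ∷_) Sₙ) (map (false ∷_) Sₙ)) ⟨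
  + length (filter P? (allSubsets (suc n))) ∎
  where
  open ≡-Reasoning
  Sₙ = allSubsets n
  Fᵗ = filter P? (map (true ∷_) Sₙ)
  Fᶠ = filter P? (map (false ∷_) Sₙ)

disagree? : (f g : Subset n → ℤ) → Decidable (λ S → f S ≢ g S)
disagree? f g S = ¬? (f S ≟ℤ g S)

χ : Subset n → Subset n → ℤ
χ C S = negOnePow ∣ S ∩ C ∣

_⊕_ : Subset n → Subset n → Subset n
_⊕_ = zipWith _xor_

negOnePow-±1 : ∀ k → negOnePow k ≡ + 1 ⊎ negOnePow k ≡ - + 1
negOnePow-±1 zero    = inj₁ refl
negOnePow-±1 (suc k) with negOnePow-±1 k
... | inj₁ eq = inj₂ (cong -_ eq)
... | inj₂ eq = inj₁ (cong -_ eq)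

χ-±1 : (C S : Subset n) → χ C S ≡ + 1 ⊎ χ C S ≡ - + 1
χ-±1 C S = negOnePow-±1 ∣ S ∩ C ∣

neg-*-neg : ∀ i j → - i * - j ≡ i * j
neg-*-neg i j = begin
  - i * - j     ≡⟨ neg-distribʳ-* (- i) j ⟨
  - (- i * j)   ≡⟨ cong -_ (neg-distribˡ-* i j) ⟨
  - - (i * j)   ≡⟨ neg-involutive (i * j) ⟩
  i * j         ∎
  where open ≡-Reasoning

χ-⊕ : (C D S : Subset n) → χ C S * χ D S ≡ χ (C ⊕ D) S
χ-⊕ []          []          []          = refl
χ-⊕ (_     ∷ C) (_     ∷ D) (false ∷ S) = χ-⊕ C D S
χ-⊕ (true  ∷ C) (true  ∷ D) (true  ∷ S) = trans (neg-*-neg (χ C S) (χ D S)) (χ-⊕ C D S)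
χ-⊕ (true  ∷ C) (false ∷ D) (true  ∷ S) =
  trans (sym (neg-distribˡ-* (χ C S) (χ D S))) (cong -_ (χ-⊕ C D S))
χ-⊕ (false ∷ C) (true  ∷ D) (true  ∷ S) =
  trans (sym (neg-distribʳ-* (χ C S) (χ D S))) (cong -_ (χ-⊕ C D S))
χ-⊕ (false ∷ C) (false ∷ D) (true  ∷ S) = χ-⊕ C D S

∑-χ-nonneg : ∀ n (C : Subset n) → + 0 ≤ ∑ n (χ C)
∑-χ-nonneg zero    []          = +≤+ ℕ.z≤n
∑-χ-nonneg (suc n) (true  ∷ C) = ≤-reflexive (sym (begin
  ∑ n (λ S → - χ C S) + ∑ n (χ C) ≡⟨ cong (_+ ∑ n (χ C)) (∑-neg n (χ C)) ⟩
  - ∑ n (χ C) + ∑ n (χ C)         ≡⟨ +-inverseˡ (∑ n (χ C)) ⟩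
  + 0                             ∎))
  where open ≡-Reasoning
∑-χ-nonneg (suc n) (false ∷ C) = +-mono-≤ (∑-χ-nonneg n C) (∑-χ-nonneg n C)

∏[1+χ] : List (Subset n) → Subset n → ℤ
∏[1+χ] []       S = + 1
∏[1+χ] (C ∷ Cs) S = (+ 1 + χ C S) * ∏[1+χ] Cs S

∑-χ*∏[1+χ]-nonneg : ∀ n (Cs : List (Subset n)) (D : Subset n) →
  + 0 ≤ ∑ n (λ S → χ D S * ∏[1+χ] Cs S)
∑-χ*∏[1+χ]-nonneg n [] D = begin
  + 0                     ≤⟨ ∑-χ-nonneg n D ⟩
  ∑ n (χ D)               ≡⟨ ∑-cong n (λ S → *-identityʳ (χ D S)) ⟨
  ∑ n (λ S → χ D S * + 1) ∎
  where open ≤-Reasoning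
∑-χ*∏[1+χ]-nonneg n (C ∷ Cs) D = begin
  + 0 + + 0
    ≤⟨ +-mono-≤ (∑-χ*∏[1+χ]-nonneg n Cs D) (∑-χ*∏[1+χ]-nonneg n Cs (D ⊕ C)) ⟩
  ∑ n (λ S → χ D S * ∏[1+χ] Cs S) + ∑ n (λ S → χ (D ⊕ C) S * ∏[1+χ] Cs S)
    ≡⟨ ∑-+ n _ _ ⟨
  ∑ n (λ S → χ D S * ∏[1+χ] Cs S + χ (D ⊕ C) S * ∏[1+χ] Cs S)
    ≡⟨ ∑-cong n expand ⟨
  ∑ n (λ S → χ D S * ((+ 1 + χ C S) * ∏[1+χ] Cs S)) ∎
  where
  open ≤-Reasoning
  distrib : ∀ x c p → x * ((+ 1 + c) * p) ≡ x * p + (x * c) * p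
  distrib = solve-∀
  expand : ∀ S → χ D S * ((+ 1 + χ C S) * ∏[1+χ] Cs S)
               ≡ χ D S * ∏[1+χ] Cs S + χ (D ⊕ C) S * ∏[1+χ] Cs S
  expand S = trans (distrib (χ D S) (χ C S) (∏[1+χ] Cs S))
                   (cong (λ x → χ D S * ∏[1+χ] Cs S + x * ∏[1+χ] Cs S) (χ-⊕ D C S))

∑-∏[1+χ]-≥ : ∀ n (Cs : List (Subset n)) → + (2 ^ n) ≤ ∑ n (∏[1+χ] Cs)
∑-∏[1+χ]-≥ n []       = ≤-reflexive (sym (∑-1 n))
∑-∏[1+χ]-≥ n (C ∷ Cs) = begin
  + (2 ^ n)                                         ≡⟨ +-identityʳ (+ (2 ^ n)) ⟨
  + (2 ^ n) + + 0                                   ≤⟨ +-mono-≤ (∑-∏[1+χ]-≥ n Cs) (∑-χ*∏[1+χ]-nonneg n Cs C) ⟩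
  ∑ n (∏[1+χ] Cs) + ∑ n (λ S → χ C S * ∏[1+χ] Cs S) ≡⟨ ∑-+ n _ _ ⟨
  ∑ n (λ S → ∏[1+χ] Cs S + χ C S * ∏[1+χ] Cs S)     ≡⟨ ∑-cong n (λ S → distrib (χ C S) (∏[1+χ] Cs S)) ⟩
  ∑ n (∏[1+χ] (C ∷ Cs))                             ∎
  where
  open ≤-Reasoning
  distrib : ∀ c p → p + c * p ≡ (+ 1 + c) * p
  distrib = solve-∀

∏[1+χ]-values : (Cs : List (Subset n)) (S : Subset n) →
  ∏[1+χ] Cs S ≡ + 0 ⊎ (All (λ C → χ C S ≡ + 1) Cs × ∏[1+χ] Cs S ≡ + (2 ^ length Cs))
∏[1+χ]-values []       S = inj₂ ([] , refl)
∏[1+χ]-values (C ∷ Cs) S with χ-±1 C S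
... | inj₂ χ≡-1 rewrite χ≡-1 = inj₁ refl
... | inj₁ χ≡1  rewrite χ≡1 with ∏[1+χ]-values Cs S
...   | inj₁ ∏≡0          = inj₁ (trans (cong (+ 2 *_) ∏≡0) (*-zeroʳ (+ 2)))
...   | inj₂ (all , ∏≡2ᵏ) =
  inj₂ (χ≡1 ∷ all , trans (cong (+ 2 *_) ∏≡2ᵏ) (sym (pos-* 2 (2 ^ length Cs))))

∏[1+χ]≤2ᵏ·𝟙 : ∀ {A : Set ℓ} (Cs : List (Subset n)) (S : Subset n) (a? : Dec A) →
  (All (λ C → χ C S ≡ + 1) Cs → A) → ∏[1+χ] Cs S ≤ + (2 ^ length Cs) * 𝟙 a?
∏[1+χ]≤2ᵏ·𝟙 Cs S a? all⇒A with ∏[1+χ]-values Cs S | a?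
... | inj₁ ∏≡0          | a?    = begin
  ∏[1+χ] Cs S             ≡⟨ ∏≡0 ⟩
  + 0                     ≡⟨ *-zeroʳ (+ (2 ^ length Cs)) ⟨
  + (2 ^ length Cs) * + 0 ≤⟨ *-monoˡ-≤-nonNeg (+ (2 ^ length Cs)) (𝟙-nonneg a?) ⟩
  + (2 ^ length Cs) * 𝟙 a? ∎
  where open ≤-Reasoning
... | inj₂ (_   , ∏≡2ᵏ) | yes _ = ≤-reflexive (trans ∏≡2ᵏ (sym (*-identityʳ (+ (2 ^ length Cs)))))
... | inj₂ (all , _)    | no ¬a = contradiction (all⇒A all) ¬a

InsertionsIncrease : (Subset n → ℤ) → Set
InsertionsIncrease f = ∀ i S → i ∉ S → f S ≤ f (S [ i ]≔ true)

insertionsIncrease-∷ : (f : Subset (suc n) → ℤ) → InsertionsIncrease f →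
  ∀ b → InsertionsIncrease (f ∘ (b ∷_))
insertionsIncrease-∷ f f↑ b i S i∉S = f↑ (fsuc i) (b ∷ S) (i∉S ∘ drop-there)

insertionsIncrease⇒monotone : (f : Subset n → ℤ) → InsertionsIncrease f → Monotone f
insertionsIncrease⇒monotone f f↑ [] [] _ = ≤-refl
insertionsIncrease⇒monotone f f↑ (true ∷ S) (true ∷ T) S⊆T =
  insertionsIncrease⇒monotone (f ∘ (true ∷_)) (insertionsIncrease-∷ f f↑ true) S T (drop-∷-⊆ S⊆T)
insertionsIncrease⇒monotone f f↑ (false ∷ S) (false ∷ T) S⊆T =
  insertionsIncrease⇒monotone (f ∘ (false ∷_)) (insertionsIncrease-∷ f f↑ false) S T (drop-∷-⊆ S⊆T)
insertionsIncrease⇒monotone f f↑ (false ∷ S) (true ∷ T) S⊆T = ≤-trans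
  (insertionsIncrease⇒monotone (f ∘ (false ∷_)) (insertionsIncrease-∷ f f↑ false) S T (drop-∷-⊆ S⊆T))
  (f↑ fzero (false ∷ T) λ ())
insertionsIncrease⇒monotone f f↑ (true ∷ S) (false ∷ T) S⊆T with S⊆T here
... | ()

Descent : (Subset n → ℤ) → Fin n → Subset n → Set
Descent f i S = i ∉ S × f (S [ i ]≔ true) < f S

descent? : (f : Subset n → ℤ) (i : Fin n) → Decidable (Descent f i)
descent? f i S = ¬? (i ∈? S) ×-dec f (S [ i ]≔ true) <? f S

descent-disagrees : (f g : Subset (suc n) → ℤ) → Monotone g → ∀ S → Descent f fzero (false ∷ S) →
  f (true ∷ S) ≢ g (true ∷ S) ⊎ f (false ∷ S) ≢ g (false ∷ S)
descent-disagrees f g g-mono S (_ , f↓) with f (true ∷ S) ≟ℤ g (true ∷ S)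
... | no  f≢g = inj₁ f≢g
... | yes f≡g = inj₂ λ f≡g′ → <⇒≱ f↓ (begin
  f (false ∷ S) ≡⟨ f≡g′ ⟩
  g (false ∷ S) ≤⟨ g-mono (false ∷ S) (true ∷ S) (out⊆ ⊆-refl) ⟩
  g (true ∷ S)  ≡⟨ f≡g ⟨
  f (true ∷ S)  ∎)
  where open ≤-Reasoning

∑-descents≤∑-disagreements : ∀ n (f g : Subset n → ℤ) → Monotone g → (i : Fin n) →
  ∑ n (𝟙 ∘ descent? f i) ≤ ∑ n (𝟙 ∘ disagree? f g)
∑-descents≤∑-disagreements (suc n) f g g-mono fzero = begin
  ∑ n (𝟙 ∘ descent? f fzero ∘ (true ∷_)) + ∑ n (𝟙 ∘ descent? f fzero ∘ (false ∷_))
    ≡⟨ ∑-+ n _ _ ⟨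
  ∑ n (λ S → 𝟙 (descent? f fzero (true ∷ S)) + 𝟙 (descent? f fzero (false ∷ S)))
    ≤⟨ ∑-mono-≤ n paired ⟩
  ∑ n (λ S → 𝟙 (disagree? f g (true ∷ S)) + 𝟙 (disagree? f g (false ∷ S)))
    ≡⟨ ∑-+ n _ _ ⟩
  ∑ n (𝟙 ∘ disagree? f g ∘ (true ∷_)) + ∑ n (𝟙 ∘ disagree? f g ∘ (false ∷_)) ∎
  where
  open ≤-Reasoning
  -- No descent at 0 starts from a set containing 0, so the first summand is + 0.
  paired : ∀ S → 𝟙 (descent? f fzero (true ∷ S)) + 𝟙 (descent? f fzero (false ∷ S))
                   ≤ 𝟙 (disagree? f g (true ∷ S)) + 𝟙 (disagree? f g (false ∷ S))
  paired S = ≤-trans (≤-reflexive (+-identityˡ _))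
                     (𝟙-⊎ (descent? f fzero (false ∷ S)) (disagree? f g (true ∷ S))
                          (disagree? f g (false ∷ S)) (descent-disagrees f g g-mono S))
∑-descents≤∑-disagreements (suc n) f g g-mono (fsuc i) = +-mono-≤ (restrict true) (restrict false)
  where
  restrict : ∀ b → ∑ n (𝟙 ∘ descent? f (fsuc i) ∘ (b ∷_)) ≤ ∑ n (𝟙 ∘ disagree? f g ∘ (b ∷_))
  restrict b = ≤-trans
    (∑-mono-≤ n (λ S → 𝟙-mono (descent? f (fsuc i) (b ∷ S)) (descent? (f ∘ (b ∷_)) i S)
                               (map₁ drop-not-there)))
    (∑-descents≤∑-disagreements n (f ∘ (b ∷_)) (g ∘ (b ∷_)) (λ S T S⊆T → g-mono _ _ (s⊆s S⊆T)) i)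

∣∩∣-insert-∈ : (i : Fin n) (S C : Subset n) → i ∉ S → i ∈ C → ∣ (S [ i ]≔ true) ∩ C ∣ ≡ suc ∣ S ∩ C ∣
∣∩∣-insert-∈ fzero    (true  ∷ S) C          i∉S _   = contradiction here i∉S
∣∩∣-insert-∈ fzero    (false ∷ S) (true ∷ C) _   _   = refl
∣∩∣-insert-∈ (fsuc i) (s     ∷ S) (c    ∷ C) i∉S i∈C with s ∧ c
... | true  = cong suc (∣∩∣-insert-∈ i S C (i∉S ∘ there) (drop-there i∈C))
... | false = ∣∩∣-insert-∈ i S C (i∉S ∘ there) (drop-there i∈C)

∩-insert-∉ : (i : Fin n) (S C : Subset n) → i ∉ C → (S [ i ]≔ true) ∩ C ≡ S ∩ C
∩-insert-∉ fzero    (_     ∷ S) (true  ∷ C) i∉C = contradiction here i∉C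
∩-insert-∉ fzero    (true  ∷ S) (false ∷ C) _   = refl
∩-insert-∉ fzero    (false ∷ S) (false ∷ C) _   = refl
∩-insert-∉ (fsuc i) (s     ∷ S) (c     ∷ C) i∉C = cong ((s ∧ c) ∷_) (∩-insert-∉ i S C (i∉C ∘ there))

∣∣-insert : (i : Fin n) (S : Subset n) → i ∉ S → ∣ S [ i ]≔ true ∣ ≡ suc ∣ S ∣
∣∣-insert i S i∉S = begin
  ∣ S [ i ]≔ true ∣       ≡⟨ cong ∣_∣ (∩-identityʳ (S [ i ]≔ true)) ⟨
  ∣ (S [ i ]≔ true) ∩ ⊤ ∣ ≡⟨ ∣∩∣-insert-∈ i S ⊤ i∉S ∈⊤ ⟩
  suc ∣ S ∩ ⊤ ∣           ≡⟨ cong (suc ∘ ∣_∣) (∩-identityʳ S) ⟩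
  suc ∣ S ∣               ∎
  where open ≡-Reasoning

χ-insert-∈ : (i : Fin n) (S C : Subset n) → i ∉ S → i ∈ C → χ C (S [ i ]≔ true) ≡ - χ C S
χ-insert-∈ i S C i∉S i∈C = cong negOnePow (∣∩∣-insert-∈ i S C i∉S i∈C)

χ-insert-∉ : (i : Fin n) (S C : Subset n) → i ∉ C → χ C (S [ i ]≔ true) ≡ χ C S
χ-insert-∉ i S C i∉C = cong (negOnePow ∘ ∣_∣) (∩-insert-∉ i S C i∉C)

χ⁅⁆-∈ : (i : Fin n) (S : Subset n) → i ∈ S → χ ⁅ i ⁆ S ≡ - + 1
χ⁅⁆-∈ {suc n} fzero (true ∷ S) _ =
  trans (cong (-_ ∘ negOnePow ∘ ∣_∣) (∩-zeroʳ S)) (cong (-_ ∘ negOnePow) (∣⊥∣≡0 n))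
χ⁅⁆-∈ (fsuc i) (true  ∷ S) i∈S = χ⁅⁆-∈ i S (drop-there i∈S)
χ⁅⁆-∈ (fsuc i) (false ∷ S) i∈S = χ⁅⁆-∈ i S (drop-there i∈S)

negOnePow≤2-negOnePow : ∀ k → negOnePow k ≤ + 2 + - negOnePow k
negOnePow≤2-negOnePow k with negOnePow k | negOnePow-±1 k
... | _ | inj₁ refl = ≤-refl
... | _ | inj₂ refl = -≤+

+[2*suc] : ∀ m → + (2 ℕ.* suc m) ≡ + 2 + + (2 ℕ.* m)
+[2*suc] m = trans (cong +_ (ℕ.*-suc 2 m)) (pos-+ 2 (2 ℕ.* m))

h-insert : (A B : Subset n) (i : Fin n) (S : Subset n) → i ∉ S →
  h A B (S [ i ]≔ true) ≡ + 2 + + (2 ℕ.* ∣ S ∣) + χ A (S [ i ]≔ true) + χ B (S [ i ]≔ true)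
h-insert A B i S i∉S = cong (λ K → K + χ A (S [ i ]≔ true) + χ B (S [ i ]≔ true))
  (trans (cong (λ m → + (2 ℕ.* m)) (∣∣-insert i S i∉S)) (+[2*suc] ∣ S ∣))

h-insertionsIncrease : (A B : Subset n) → A ∩ B ≡ ⊥ → InsertionsIncrease (h A B)
h-insertionsIncrease A B A∩B≡⊥ i S i∉S = begin
  K + χ A S + χ B S            ≡⟨ +-assoc K (χ A S) (χ B S) ⟩
  K + (χ A S + χ B S)          ≤⟨ +-monoʳ-≤ K (signs (i ∈? A) (i ∈? B)) ⟩
  K + (+ 2 + (χ A S′ + χ B S′)) ≡⟨ regroup K (χ A S′) (χ B S′) ⟩
  + 2 + K + χ A S′ + χ B S′    ≡⟨ h-insert A B i S i∉S ⟨
  h A B S′                     ∎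
  where
  open ≤-Reasoning
  K  = + (2 ℕ.* ∣ S ∣)
  S′ = S [ i ]≔ true
  regroup : ∀ K x y → K + (+ 2 + (x + y)) ≡ + 2 + K + x + y
  regroup = solve-∀
  signs : Dec (i ∈ A) → Dec (i ∈ B) → χ A S + χ B S ≤ + 2 + (χ A S′ + χ B S′)
  signs (yes i∈A) (yes i∈B) = contradiction (subst (i ∈_) A∩B≡⊥ (x∈p∩q⁺ (i∈A , i∈B))) ∉⊥
  signs (yes i∈A) (no  i∉B) rewrite χ-insert-∈ i S A i∉S i∈A | χ-insert-∉ i S B i∉B = ≤-trans
    (+-monoˡ-≤ (χ B S) (negOnePow≤2-negOnePow ∣ S ∩ A ∣))
    (≤-reflexive (+-assoc (+ 2) (- χ A S) (χ B S)))
  signs (no  i∉A) (yes i∈B) rewrite χ-insert-∉ i S A i∉A | χ-insert-∈ i S B i∉S i∈B = ≤-trans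
    (+-monoʳ-≤ (χ A S) (negOnePow≤2-negOnePow ∣ S ∩ B ∣))
    (≤-reflexive (x∙yz≈y∙xz (χ A S) (+ 2) (- χ B S)))
  signs (no  i∉A) (no  i∉B) rewrite χ-insert-∉ i S A i∉A | χ-insert-∉ i S B i∉B = i≤j+i _ (+ 2)

h-descent : (A B : Subset n) (i : Fin n) → i ∈ A → i ∈ B →
  ∀ S → All (λ C → χ C S ≡ + 1) (⁅ i ⁆ ∷ A ∷ B ∷ []) → Descent (h A B) i S
h-descent A B i i∈A i∈B S (χ⁅i⁆≡1 ∷ χA≡1 ∷ χB≡1 ∷ []) = i∉S , (begin-strict
  h A B S′                      ≡⟨ h-insert A B i S i∉S ⟩
  + 2 + K + χ A S′ + χ B S′     ≡⟨ cong₂ (λ x y → + 2 + K + x + y) (χ-insert-∈ i S A i∉S i∈A)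
                                                                     (χ-insert-∈ i S B i∉S i∈B) ⟩
  + 2 + K + - χ A S + - χ B S   ≡⟨ cong₂ (λ x y → + 2 + K + - x + - y) χA≡1 χB≡1 ⟩
  + 2 + K + - + 1 + - + 1       ≡⟨ cancel K ⟩
  K + + 0                       <⟨ +-monoʳ-< K (+<+ (ℕ.s≤s ℕ.z≤n)) ⟩
  K + (+ 1 + + 1)               ≡⟨ +-assoc K (+ 1) (+ 1) ⟨
  K + + 1 + + 1                 ≡⟨ cong₂ (λ x y → K + x + y) χA≡1 χB≡1 ⟨
  h A B S                       ∎)
  where
  open ≤-Reasoning
  K  = + (2 ℕ.* ∣ S ∣)
  S′ = S [ i ]≔ true
  i∉S : i ∉ S
  i∉S i∈S with () ← trans (sym χ⁅i⁆≡1) (χ⁅⁆-∈ i S i∈S)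
  cancel : ∀ K → + 2 + K + - + 1 + - + 1 ≡ K + + 0
  cancel = solve-∀

h-farFromMonotone : (A B : Subset n) (i : Fin n) → i ∈ A → i ∈ B → FarFromMonotone 1 8 (h A B)
h-farFromMonotone {n} A B i i∈A i∈B g g-mono = drop‿+≤+ (begin
  + (1 ℕ.* 2 ^ n)                      ≡⟨ cong +_ (ℕ.*-identityˡ (2 ^ n)) ⟩
  + (2 ^ n)                            ≤⟨ ∑-∏[1+χ]-≥ n (⁅ i ⁆ ∷ A ∷ B ∷ []) ⟩
  ∑ n (∏[1+χ] (⁅ i ⁆ ∷ A ∷ B ∷ []))   ≤⟨ ∑-mono-≤ n (λ S → ∏[1+χ]≤2ᵏ·𝟙 (⁅ i ⁆ ∷ A ∷ B ∷ []) S
                                                      (descent? (h A B) i S) (h-descent A B i i∈A i∈B S)) ⟩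
  ∑ n (λ S → + 8 * 𝟙 (descent? (h A B) i S)) ≡⟨ ∑-*ˡ n (+ 8) (𝟙 ∘ descent? (h A B) i) ⟩
  + 8 * ∑ n (𝟙 ∘ descent? (h A B) i)   ≤⟨ *-monoˡ-≤-nonNeg (+ 8)
                                              (∑-descents≤∑-disagreements n (h A B) g g-mono i) ⟩
  + 8 * ∑ n (𝟙 ∘ disagree? (h A B) g)  ≡⟨ cong (+ 8 *_) (∑-𝟙 n (disagree? (h A B) g)) ⟩
  + 8 * + numDiff (h A B) g            ≡⟨ pos-* 8 (numDiff (h A B) g) ⟨
  + (8 ℕ.* numDiff (h A B) g)          ∎)
  where open ≤-Reasoning

∣p∣≡1+k⇒nonempty : ∀ {k} (p : Subset n) → ∣ p ∣ ≡ suc k → Nonempty p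
∣p∣≡1+k⇒nonempty {n} p ∣p∣≡1+k with nonempty? p
... | yes nonempty = nonempty
... | no  empty with () ← trans (sym ∣p∣≡1+k) (trans (cong ∣_∣ (Empty-unique empty)) (∣⊥∣≡0 n))

lemma8p4 : (n : ℕ) (A B : Subset n)
    → ((A ∩ B ≡ ⊥ → Monotone (h A B))
       × (∣ A ∩ B ∣ ≡ 1 → FarFromMonotone 1 8 (h A B)))
lemma8p4 n A B = monotone , far
  where
  monotone : A ∩ B ≡ ⊥ → Monotone (h A B)
  monotone A∩B≡⊥ = insertionsIncrease⇒monotone (h A B) (h-insertionsIncrease A B A∩B≡⊥)
  far : ∣ A ∩ B ∣ ≡ 1 → FarFromMonotone 1 8 (h A B)
  far ∣A∩B∣≡1 with i , i∈A∩B ← ∣p∣≡1+k⇒nonempty (A ∩ B) ∣A∩B∣≡1 =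
    let i∈A , i∈B = x∈p∩q⁻ A B i∈A∩B in h-farFromMonotone A B i i∈A i∈B
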